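{- Let $(e,f)$ and $(g,h)$ be independent full crosses of a messy ladder $(L,W,X)$, with $W$-spans $W[e_W,f_W]$, $W[g_W,h_W]$ and $X$-spans $X[f_X,e_X]$, $X[h_X,g_X]$, respectively. Then $f_W\le g_W$ if and only if $e_X\le h_X$.
   Context: On a ray, $a\le b$ ($a<b$) means $a$ lies on the subpath from the initial vertex to $b$ (and $a\neq b$); $W[a,b]$ denotes that subpath. Two rays are in the same end if there are infinitely many pairwise disjoint paths joining them. A (infinite) messy ladder is a triple $(L,W,X)$ where $L$ is a locally finite graph all of whose vertices lie on two disjoint induced rays $W,X$ of $L$ (rails) which are in the same end of $L$, and $L$ has an edge between the initial vertices of $W$ and $X$. Edges not on $W$ or $X$ are rungs; for a rung $e$, $e_W$ and $e_X$ are its ends on $W$ and $X$. An ordered pair of rungs $(e,f)$ is a cross if $e_W<f_W$ and $f_X<e_X$; its $W$-span is $W[e_W,f_W]$ and its $X$-span is $X[f_X,e_X]$. A cross is full if the ladder has no other cross whose $W$-span contains its $W$-span and whose $X$-span contains its $X$-span. Two crosses are independent if their $W$-spans are edge-disjoint and their $X$-spans are edge-disjoint. -}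

module Defs where

open import Level using (0ℓ)
open import Data.Nat using (ℕ; zero; suc; _≤_; _<_)
open import Data.Sum using (_⊎_; inj₁; inj₂)
open import Data.Product using (Σ; ∃; ∃-syntax; _×_; _,_)
open import Data.List using (List; []; _∷_; _++_)
open import Data.List.Relation.Unary.Linked using (Linked)
open import Data.List.Relation.Unary.Unique.Propositional using (Unique)
open import Data.List.Membership.Propositional using (_∈_)
open import Relation.Binary.PropositionalEquality using (_≡_; _≢_)
open import Relation.Nullary using (¬_)

-- Vertices of a messy ladder: every vertex lies on one of the two rails.
--   inj₁ i  is the i-th vertex of W (W_0 is the initial vertex),
--   inj₂ j  is the j-th vertex of X.
-- Order on a ray: W_i ≤ W_i' iff i ≤ i'.
Vertex : Set
Vertex = ℕ ⊎ ℕ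

-- Rail adjacency: consecutive indices (the rails are induced rays, so there
-- are no other edges between two vertices of the same rail).
RailAdj : ℕ → ℕ → Set
RailAdj i i' = (i' ≡ suc i) ⊎ (i ≡ suc i')

-- The edge relation of the graph L, given its rung relation R
-- (R i j  means  W_i X_j  is an edge of L, i.e. a rung).
Adj : (ℕ → ℕ → Set) → Vertex → Vertex → Set
Adj R (inj₁ i) (inj₁ i') = RailAdj i i'
Adj R (inj₂ j) (inj₂ j') = RailAdj j j'
Adj R (inj₁ i) (inj₂ j)  = R i j
Adj R (inj₂ j) (inj₁ i)  = R i j

record WXPath (R : ℕ → ℕ → Set) : Set where
  field
    w     : ℕ
    x     : ℕ
    inner : List Vertex
  verts : List Vertex
  verts = inj₁ w ∷ (inner ++ (inj₂ x ∷ []))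
  field
    linked : Linked (Adj R) verts
    unique : Unique verts

Disjoint : {R : ℕ → ℕ → Set} → WXPath R → WXPath R → Set
Disjoint P Q = ∀ v → v ∈ WXPath.verts P → v ∈ WXPath.verts Q → ⊥'
  where open import Data.Empty renaming (⊥ to ⊥')

-- W and X are in the same end of L: infinitely many pairwise disjoint
-- paths joining them (an injectively indexed ℕ-family of pairwise disjoint paths).
SameEnd : (ℕ → ℕ → Set) → Set
SameEnd R = Σ (ℕ → WXPath R) λ P → ∀ m n → m ≢ n → Disjoint (P m) (P n)

-- A messy ladder (L, W, X), with L determined by its rung relation.
record MessyLadder : Set₁ where
  field
    R         : ℕ → ℕ → Set
    -- L is locally finite (every vertex has finitely many neighbours;
    -- rail vertices have at most two rail neighbours, so it suffices
    -- that the rungs at each vertex are bounded)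
    locFinW   : ∀ i → ∃[ n ] (∀ j → R i j → j < n)
    locFinX   : ∀ j → ∃[ n ] (∀ i → R i j → i < n)
    sameEnd   : SameEnd R
    initial   : R 0 0

-- A rung e is recorded by its pair of ends (e_W , e_X).
Rung : Set
Rung = ℕ × ℕ

module _ (L : MessyLadder) where
  open MessyLadder L

  IsRung : Rung → Set
  IsRung (a , b) = R a b

  IsCross : Rung → Rung → Set
  IsCross (eW , eX) (fW , fX) =
    IsRung (eW , eX) × IsRung (fW , fX) × eW < fW × fX < eX

  SpansContain : Rung → Rung → Rung → Rung → Set
  SpansContain (gW , gX) (hW , hX) (eW , eX) (fW , fX) =
    (gW ≤ eW × fW ≤ hW) × (hX ≤ fX × eX ≤ gX)

  IsFullCross : Rung → Rung → Set
  IsFullCross e f =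
    IsCross e f ×
    (∀ g h → IsCross g h → SpansContain g h e f → (g , h) ≡ (e , f))

  -- the edge W_k W_{k+1} lies on the subpath W[a,b]
  EdgeIn : ℕ → ℕ → ℕ → Set
  EdgeIn a b k = a ≤ k × suc k ≤ b

  Independent : Rung → Rung → Rung → Rung → Set
  Independent (eW , eX) (fW , fX) (gW , gX) (hW , hX) =
    (∀ k → EdgeIn eW fW k → EdgeIn gW hW k → ⊥') ×
    (∀ k → EdgeIn fX eX k → EdgeIn hX gX k → ⊥')
    where open import Data.Empty renaming (⊥ to ⊥')

-- Edge-disjoint spans on a rail are linearly ordered.  If f_W ≤ g_W but h_X < e_X,
-- the X-spans force g_X ≤ f_X, and then (e,h) is a cross whose spans contain
-- those of (e,f); fullness gives h = f, impossible as f_W ≤ g_W < h_W.  The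
-- converse is the same argument on W, with the cross (g,f).
module Submission where

open import Defs
open import Data.Nat using (ℕ; suc; _≤_; _<_; _⊔_)
open import Data.Nat.Properties
  using (≤-refl; ≤-trans; <⇒≤; <-≤-trans; ≤-<-trans; <-irrefl; ≮⇒≥; m≤m⊔n; m≤n⊔m; ⊔-lub)
open import Data.Empty using (⊥)
open import Data.Product using (_×_; _,_; proj₁; proj₂)
open import Function using (_∘_)
open import Relation.Binary.PropositionalEquality using (cong; sym)

edge-disjoint⇒separated : ∀ {a b c d} → a < b → c < d →
  (∀ k → a ≤ k × suc k ≤ b → c ≤ k × suc k ≤ d → ⊥) →
  c < b → d ≤ a
-- The shared edge starts at a ⊔ c; ⊔-lub applies to < since suc a ⊔ suc c = suc (a ⊔ c).
edge-disjoint⇒separated {a} {c = c} a<b c<d disjoint c<b = ≮⇒≥ λ a<d →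
  disjoint (a ⊔ c) (m≤m⊔n a c , ⊔-lub a<b c<b) (m≤n⊔m a c , ⊔-lub a<d c<d)

precedesW⇒precedesX : (L : MessyLadder) {eW eX fW fX gW gX hW hX : ℕ} →
  IsFullCross L (eW , eX) (fW , fX) → IsCross L (gW , gX) (hW , hX) →
  (∀ k → EdgeIn L fX eX k → EdgeIn L hX gX k → ⊥) →
  fW ≤ gW → eX ≤ hX
precedesW⇒precedesX L {eW} {eX} {hW = hW} {hX}
  ((Re , _ , eW<fW , fX<eX) , maximal) (_ , Rh , gW<hW , hX<gX) disjointX fW≤gW =
  ≮⇒≥ λ hX<eX →
    let gX≤fX = edge-disjoint⇒separated fX<eX hX<gX disjointX hX<eX
        fW≤hW = ≤-trans fW≤gW (<⇒≤ gW<hW)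
        cross-eh = Re , Rh , <-≤-trans eW<fW fW≤hW , hX<eX
        h≡f = cong (proj₁ ∘ proj₂) (maximal (eW , eX) (hW , hX) cross-eh
                ((≤-refl , fW≤hW) , (<⇒≤ (<-≤-trans hX<gX gX≤fX) , ≤-refl)))
    in <-irrefl (sym h≡f) (≤-<-trans fW≤gW gW<hW)

precedesX⇒precedesW : (L : MessyLadder) {eW eX fW fX gW gX hW hX : ℕ} →
  IsFullCross L (eW , eX) (fW , fX) → IsCross L (gW , gX) (hW , hX) →
  (∀ k → EdgeIn L eW fW k → EdgeIn L gW hW k → ⊥) →
  eX ≤ hX → fW ≤ gW
precedesX⇒precedesW L {fW = fW} {fX} {gW} {gX}
  ((_ , Rf , eW<fW , fX<eX) , maximal) (Rg , _ , gW<hW , hX<gX) disjointW eX≤hX =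
  ≮⇒≥ λ gW<fW →
    let hW≤eW = edge-disjoint⇒separated eW<fW gW<hW disjointW gW<fW
        eX≤gX = ≤-trans eX≤hX (<⇒≤ hX<gX)
        cross-gf = Rg , Rf , gW<fW , <-≤-trans fX<eX eX≤gX
        g≡e = cong (proj₁ ∘ proj₁) (maximal (gW , gX) (fW , fX) cross-gf
                ((<⇒≤ (<-≤-trans gW<hW hW≤eW) , ≤-refl) , (≤-refl , eX≤gX)))
    in <-irrefl g≡e (<-≤-trans gW<hW hW≤eW)

lemma4p2 : (L : MessyLadder) (eW eX fW fX gW gX hW hX : ℕ) →
    IsFullCross L (eW , eX) (fW , fX) →
    IsFullCross L (gW , gX) (hW , hX) →
    Independent L (eW , eX) (fW , fX) (gW , gX) (hW , hX) →
    (fW ≤ gW → eX ≤ hX) × (eX ≤ hX → fW ≤ gW)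
lemma4p2 L _ _ _ _ _ _ _ _ full-ef (cross-gh , _) (disjointW , disjointX) =
  precedesW⇒precedesX L full-ef cross-gh disjointX ,
  precedesX⇒precedesW L full-ef cross-gh disjointW
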